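{- Let $\ell\ge1$ and $n\ge 2\ell+3$ be integers. The degree list of any $n$-vertex tree is determined by its $(n-\ell)$-deck: any two $n$-vertex trees with the same $(n-\ell)$-deck have the same multiset of vertex degrees.
   Context: The $(n-\ell)$-deck of an $n$-vertex graph is the multiset of its (unlabeled) induced subgraphs on $n-\ell$ vertices. -}

module Defs where

open import Data.Nat using (ℕ; zero; suc; _+_; _∸_)
open import Data.Bool using (Bool; true; false; if_then_else_)
open import Data.Fin using (Fin; _<_)
open import Data.Fin.Subset using (Subset; _∈_; ∣_∣)
open import Data.Vec using (Vec)
open import Data.List using (List; map; filter)
open import Data.Nat.ListAction using (sum)
open import Data.List using (allFin)
open import Data.Product using (Σ; _×_; _,_; proj₁)
open import Function.Bundles using (_↔_; Inverse)
open import Relation.Binary.PropositionalEquality using (_≡_)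
open import Relation.Nullary using (¬_)
open import Data.Fin using (_<?_)

record Graph (n : ℕ) : Set where
  field
    adj   : Fin n → Fin n → Bool
    sym   : ∀ i j → adj i j ≡ adj j i
    irrefl : ∀ i → adj i i ≡ false
open Graph public

degree : ∀ {n} → Graph n → Fin n → ℕ
degree G i = sum (map (λ j → if adj G i j then 1 else 0) (allFin _))

edgeCount : ∀ {n} → Graph n → ℕ
edgeCount {n} G =
  sum (map (λ i → sum (map (λ j → if adj G i j then 1 else 0)
                           (filter (i <?_) (allFin n))))
           (allFin n))

data Walk {n : ℕ} (G : Graph n) : Fin n → Fin n → Set where
  here : ∀ {u} → Walk G u u
  step : ∀ {u w v} → adj G u w ≡ true → Walk G w v → Walk G u v

Connected : ∀ {n} → Graph n → Set
Connected G = ∀ u v → Walk G u v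

IsTree : ∀ {n} → Graph n → Set
IsTree {n} G = Connected G × edgeCount G ≡ n ∸ 1

KSubset : ℕ → ℕ → Set
KSubset n k = Σ (Subset n) (λ S → ∣ S ∣ ≡ k)

Elem : ∀ {n} → Subset n → Set
Elem {n} S = Σ (Fin n) (λ v → v ∈ S)

InducedIso : ∀ {n m} → Graph n → Subset n → Graph m → Subset m → Set
InducedIso G S H T =
  Σ (Elem S ↔ Elem T) (λ f →
     ∀ x y → adj G (proj₁ x) (proj₁ y) ≡ adj H (proj₁ (Inverse.to f x)) (proj₁ (Inverse.to f y)))

-- G and H have the same k-deck: the multisets of isomorphism classes of
-- induced subgraphs on k vertices agree, i.e. there is a bijection between
-- the k-subsets of V(G) and of V(H) matching isomorphic induced subgraphs.
SameDeck : ∀ {n} → ℕ → Graph n → Graph n → Set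
SameDeck {n} k G H =
  Σ (KSubset n k ↔ KSubset n k) (λ φ →
     ∀ S → InducedIso G (proj₁ S) H (proj₁ (Inverse.to φ S)))

SameDegreeList : ∀ {n} → Graph n → Graph n → Set
SameDegreeList {n} G H =
  Σ (Fin n ↔ Fin n) (λ σ → ∀ v → degree G v ≡ degree H (Inverse.to σ v))

-- Kelly's counting: summing Σ_{v ∈ S} C(deg_{G[S]} v, j) over the k-subsets S counts the pairs
-- (v, J) with J a j-set of neighbours of v once for every k-set containing v and J, so it equals
-- C(n-1-j, k-1-j) · Σ_v C(deg v, j).  Hence the (n-ℓ)-deck determines the binomial moments
-- Σ_v C(deg v, j) for j < n-ℓ.  In a tree the degrees are positive and sum to 2(n-1), so two
-- degrees add up to at most n and a vertex of degree D ≥ n-ℓ leaves all other degrees ≤ ℓ.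
-- The moments of orders ℓ+1 and ℓ+2 of such a tree are C(D, ℓ+1) and C(D, ℓ+2); by the
-- absorption identity these two values force any degree sequence having them to consist of a
-- single D and values ≤ ℓ, so all higher moments agree as well.  Without such a vertex in either
-- tree the moments of order ≥ n-ℓ vanish.  Finally, all binomial moments determine the multiset
-- of degrees by descending induction on the degree.

module Submission where

open import Data.Bool.Base using (Bool; true; false; if_then_else_; _∧_; _∨_)
open import Data.Bool.Properties using (∨-identityʳ)
open import Data.Empty using (⊥-elim)
open import Data.Fin.Base using (Fin; zero; suc; toℕ; fromℕ<; _↑ˡ_; _↑ʳ_; punchIn; punchOut)
open import Data.Fin.Properties
  using (+↔⊎; splitAt-↑ˡ; splitAt-↑ʳ; punchIn-punchOut; punchInᵢ≢i; toℕ-fromℕ<; toℕ-injective; any?)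
import Data.Fin.Properties as Fin using (<-cmp; _<?_)
open import Data.Fin.Subset using (Subset; inside; outside; _∩_; _∪_; ⁅_⁆; ∣_∣; _∈_; _∉_; ⊤)
open import Data.Fin.Subset.Properties using (_∈?_; ∣p∣≤n; p⊆q⇒∣p∣≤∣q∣; p∩q⊆p; ∪-identityʳ; ∩-identityˡ; ∈⊤)
import Data.List.Base as List using (List; []; _∷_; map; filter; tabulate; allFin)
open import Data.Nat.Base
open import Data.Nat.Combinatorics using (_C_; nCn≡1; nC1≡n; nCk≡nC[n∸k]; k>n⇒nCk≡0; nCk+nC[k+1]≡[n+1]C[k+1])
import Data.Nat.ListAction as List using (sum)
open import Data.Nat.Properties
open import Data.Nat.Tactic.RingSolver using (solve-∀)
open import Algebra.Properties.Semiring.Sum +-*-semiring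
  using (sum-syntax; sum-cong-≗; ∑-distrib-+; ∑-comm; sum-permute; *-distribˡ-sum; *-distribʳ-sum; sum-remove; sum-replicate-zero)
open import Data.Product using (Σ; _,_; proj₁; proj₂)
open import Data.Product.Function.Dependent.Propositional using (Σ-↔)
open import Data.Sum.Base using (_⊎_; inj₁; inj₂)
import Data.Sum.Base as Sum using (map)
open import Data.Vec.Base using ([]; _∷_; here; there; tabulate)
open import Data.Vec.Properties using (lookup∘tabulate; []=⇒lookup)
open import Data.Vec.Properties.WithK using ([]=-irrelevant)
open import Function.Base using (_∘_)
open import Function.Bundles using (_↔_; Inverse; mk↔ₛ′)
open import Function.Properties.Inverse using (↔-refl; ↔-sym; ↔-trans)
open import Relation.Binary.Definitions using (tri<; tri≈; tri>)
open import Relation.Binary.PropositionalEquality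
open import Relation.Nullary using (Dec; yes; no; does; Irrelevant; ¬_)
open import Relation.Unary using (Decidable)
open import Defs hiding (sym)

𝟙 : Bool → ℕ
𝟙 b = if b then 1 else 0

∑-split : ∀ m n (f : Fin (m + n) → ℕ) →
  ∑[ i < m + n ] f i ≡ ∑[ i < m ] f (i ↑ˡ n) + ∑[ i < n ] f (m ↑ʳ i)
∑-split zero    n f = refl
∑-split (suc m) n f = trans (cong (f zero +_) (∑-split m n (f ∘ suc))) (sym (+-assoc (f zero) _ _))

∑-reindex : ∀ {m n} (π : Fin m ↔ Fin n) (f : Fin n → ℕ) → ∑[ i < m ] f (Inverse.to π i) ≡ ∑[ j < n ] f j
∑-reindex π f = sym (sum-permute f π)

∑-ones : ∀ n → ∑[ i < n ] 1 ≡ n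
∑-ones zero    = refl
∑-ones (suc n) = cong suc (∑-ones n)

∑-mono-≤ : ∀ {n} {f g : Fin n → ℕ} → (∀ i → f i ≤ g i) → ∑[ i < n ] f i ≤ ∑[ i < n ] g i
∑-mono-≤ {zero}  f≤g = z≤n
∑-mono-≤ {suc n} f≤g = +-mono-≤ (f≤g zero) (∑-mono-≤ (f≤g ∘ suc))

pointwise≤∧∑≡⇒≡ : ∀ {n} {f g : Fin n → ℕ} → (∀ i → f i ≤ g i) → ∑[ i < n ] f i ≡ ∑[ i < n ] g i →
  ∀ i → f i ≡ g i
pointwise≤∧∑≡⇒≡ {suc n} {f} {g} f≤g ∑f≡∑g = pointwise
  where
  head≡ : f zero ≡ g zero
  head≡ = ≤-antisym (f≤g zero)
    (+-cancelʳ-≤ _ _ _ (≤-trans (+-monoʳ-≤ (g zero) (∑-mono-≤ (f≤g ∘ suc))) (≤-reflexive (sym ∑f≡∑g))))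
  pointwise : ∀ i → f i ≡ g i
  pointwise zero    = head≡
  pointwise (suc i) = pointwise≤∧∑≡⇒≡ (f≤g ∘ suc) (+-cancelˡ-≡ (f zero) _ _ (trans ∑f≡∑g (cong (_+ _) (sym head≡)))) i

∑-remove : ∀ {n} (f : Fin (suc n) → ℕ) i → ∑[ j < suc n ] f j ≡ f i + ∑[ j < n ] f (punchIn i j)
∑-remove f i = sum-remove {i = i} f

term≤∑ : ∀ {n} (f : Fin n → ℕ) i → f i ≤ ∑[ j < n ] f j
term≤∑ {suc n} f i = ≤-trans (m≤m+n (f i) _) (≤-reflexive (sym (∑-remove f i)))

pair≤∑ : ∀ {n} (f : Fin n → ℕ) {i j} → i ≢ j → f i + f j ≤ ∑[ k < n ] f k
pair≤∑ {suc n} f {i} {j} i≢j = begin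
  f i + f j                                   ≡⟨ cong (λ k → f i + f k) (sym (punchIn-punchOut i≢j)) ⟩
  f i + f (punchIn i (punchOut i≢j))          ≤⟨ +-monoʳ-≤ (f i) (term≤∑ (f ∘ punchIn i) (punchOut i≢j)) ⟩
  f i + ∑[ k < n ] f (punchIn i k)            ≡⟨ sym (∑-remove f i) ⟩
  ∑[ k < suc n ] f k                          ∎
  where open ≤-Reasoning

∑-single : ∀ {n} (f : Fin n → ℕ) i → (∀ j → j ≢ i → f j ≡ 0) → ∑[ j < n ] f j ≡ f i
∑-single {suc n} f i others = begin
  ∑[ j < suc n ] f j                ≡⟨ ∑-remove f i ⟩
  f i + ∑[ j < n ] f (punchIn i j)  ≡⟨ cong (f i +_) (sum-cong-≗ (λ j → others _ (punchInᵢ≢i i j))) ⟩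
  f i + ∑[ j < n ] 0                ≡⟨ cong (f i +_) (sum-replicate-zero n) ⟩
  f i + 0                           ≡⟨ +-identityʳ (f i) ⟩
  f i                               ∎
  where open ≡-Reasoning


⟦_⟧ : ∀ {P : Set} → Dec P → ℕ
⟦ P? ⟧ = 𝟙 (does P?)

⟦⟧*-vanish : ∀ {P : Set} (P? : Dec P) {x} → (P → x ≡ 0) → ⟦ P? ⟧ * x ≡ 0
⟦⟧*-vanish (yes p) x≡0 = trans (+-identityʳ _) (x≡0 p)
⟦⟧*-vanish (no _)  _   = refl

⟦⟧-yes : ∀ {P : Set} (P? : Dec P) → P → ⟦ P? ⟧ ≡ 1
⟦⟧-yes (yes _) _  = refl
⟦⟧-yes (no ¬p) p  = ⊥-elim (¬p p)

⟦⟧-no : ∀ {P : Set} (P? : Dec P) → ¬ P → ⟦ P? ⟧ ≡ 0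
⟦⟧-no (yes p) ¬p = ⊥-elim (¬p p)
⟦⟧-no (no _)  _  = refl

∑-zero : ∀ {n} (f : Fin n → ℕ) → (∀ i → f i ≡ 0) → ∑[ i < n ] f i ≡ 0
∑-zero {n} f f≡0 = trans (sum-cong-≗ f≡0) (sum-replicate-zero n)

∑-cancel-single : ∀ {n} (f g : Fin n → ℕ) i → (∀ j → j ≢ i → f j ≡ g j) →
  ∑[ j < n ] f j ≡ ∑[ j < n ] g j → f i ≡ g i
∑-cancel-single {suc n} f g i others ∑f≡∑g = +-cancelʳ-≡ _ (f i) (g i) (begin
  f i + ∑[ j < n ] f (punchIn i j)   ≡⟨ sym (∑-remove f i) ⟩
  ∑[ j < suc n ] f j                 ≡⟨ ∑f≡∑g ⟩
  ∑[ j < suc n ] g j                 ≡⟨ ∑-remove g i ⟩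
  g i + ∑[ j < n ] g (punchIn i j)   ≡⟨ cong (g i +_) (sum-cong-≗ (λ j → sym (others _ (punchInᵢ≢i i j)))) ⟩
  g i + ∑[ j < n ] f (punchIn i j)   ∎)
  where open ≡-Reasoning

-- Binomial coefficients

C-zeroʳ : ∀ n → n C 0 ≡ 1
C-zeroʳ n = trans (nCk≡nC[n∸k] {k = 0} {n = n} z≤n) (nCn≡1 n)

C-zeroʳ-≡ : ∀ m n → m C 0 ≡ n C 0
C-zeroʳ-≡ m n = trans (C-zeroʳ m) (sym (C-zeroʳ n))

C-pascal : ∀ n k → suc n C suc k ≡ n C k + n C suc k
C-pascal n k = sym (nCk+nC[k+1]≡[n+1]C[k+1] n k)

C-pos : ∀ {n k} → k ≤ n → 0 < n C k
C-pos {n} {zero}  _         = ≤-reflexive (sym (C-zeroʳ n))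
C-pos {suc n} {suc k} (s≤s k≤n) = ≤-trans (C-pos k≤n) (≤-trans (m≤m+n _ _) (≤-reflexive (sym (C-pascal n k))))

C-≤-suc : ∀ n k → n C k ≤ suc n C k
C-≤-suc n zero    = ≤-reflexive (trans (C-zeroʳ n) (sym (C-zeroʳ (suc n))))
C-≤-suc n (suc k) = ≤-trans (m≤n+m _ _) (≤-reflexive (sym (C-pascal n k)))

C-monoˡ-≤ : ∀ {m n} k → m ≤ n → m C k ≤ n C k
C-monoˡ-≤ k m≤n = go (≤⇒≤′ m≤n)
  where
  go : ∀ {m n} → m ≤′ n → m C k ≤ n C k
  go ≤′-refl        = ≤-refl
  go (≤′-step m≤′n) = ≤-trans (go m≤′n) (C-≤-suc _ k)

C-<-suc : ∀ {n k} → k ≤ n → n C suc k < suc n C suc k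
C-<-suc {n} {k} k≤n = ≤-trans (+-monoˡ-≤ (n C suc k) (C-pos k≤n)) (≤-reflexive (sym (C-pascal n k)))

C-absorb : ∀ e m → (e C suc m) * suc m ≡ (e C m) * (e ∸ m)
C-absorb zero m = begin
  (0 C suc m) * suc m   ≡⟨ cong (_* suc m) (k>n⇒nCk≡0 {0} {suc m} (s≤s z≤n)) ⟩
  0                     ≡⟨ sym (*-zeroʳ (0 C m)) ⟩
  (0 C m) * 0           ≡⟨ cong ((0 C m) *_) (sym (0∸n≡0 m)) ⟩
  (0 C m) * (0 ∸ m)     ∎
  where open ≡-Reasoning
C-absorb (suc e) zero = begin
  (suc e C 1) * 1       ≡⟨ *-identityʳ _ ⟩
  suc e C 1             ≡⟨ nC1≡n (suc e) ⟩
  suc e                 ≡⟨ sym (*-identityˡ (suc e)) ⟩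
  1 * suc e             ≡⟨ cong (_* suc e) (sym (C-zeroʳ (suc e))) ⟩
  (suc e C 0) * suc e   ∎
  where open ≡-Reasoning
C-absorb (suc e) (suc m) with m <? e
... | yes m<e = begin
  (suc e C suc (suc m)) * suc (suc m)
    ≡⟨ cong (_* suc (suc m)) (C-pascal e (suc m)) ⟩
  (e C suc m + e C suc (suc m)) * suc (suc m)
    ≡⟨ *-distribʳ-+ (suc (suc m)) (e C suc m) _ ⟩
  (e C suc m) * suc (suc m) + (e C suc (suc m)) * suc (suc m)
    ≡⟨ cong ((e C suc m) * suc (suc m) +_) (C-absorb e (suc m)) ⟩
  (e C suc m) * suc (suc m) + (e C suc m) * (e ∸ suc m)
    ≡⟨ sym (*-distribˡ-+ (e C suc m) _ _) ⟩
  (e C suc m) * suc (suc m + (e ∸ suc m))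
    ≡⟨ cong (λ t → (e C suc m) * suc t) (trans (m+[n∸m]≡n m<e) (sym (m+[n∸m]≡n (<⇒≤ m<e)))) ⟩
  (e C suc m) * (suc m + (e ∸ m))
    ≡⟨ *-distribˡ-+ (e C suc m) (suc m) _ ⟩
  (e C suc m) * suc m + (e C suc m) * (e ∸ m)
    ≡⟨ cong (_+ (e C suc m) * (e ∸ m)) (C-absorb e m) ⟩
  (e C m) * (e ∸ m) + (e C suc m) * (e ∸ m)
    ≡⟨ sym (*-distribʳ-+ (e ∸ m) (e C m) _) ⟩
  (e C m + e C suc m) * (e ∸ m)
    ≡⟨ cong (_* (e ∸ m)) (sym (C-pascal e m)) ⟩
  (suc e C suc m) * (suc e ∸ suc m)
    ∎
  where open ≡-Reasoning
... | no m≮e = begin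
  (suc e C suc (suc m)) * suc (suc m)
    ≡⟨ cong (_* suc (suc m)) (k>n⇒nCk≡0 {suc e} {suc (suc m)} (s≤s (s≤s (≮⇒≥ m≮e)))) ⟩
  0
    ≡⟨ sym (*-zeroʳ (suc e C suc m)) ⟩
  (suc e C suc m) * 0
    ≡⟨ cong ((suc e C suc m) *_) (sym (m≤n⇒m∸n≡0 (≮⇒≥ m≮e))) ⟩
  (suc e C suc m) * (e ∸ m)
    ∎
  where open ≡-Reasoning

C-+𝟙 : ∀ x b j → (x + 𝟙 b) C suc j ≡ x C suc j + 𝟙 b * (x C j)
C-+𝟙 x false j = trans (cong (_C suc j) (+-identityʳ x)) (sym (+-identityʳ (x C suc j)))
C-+𝟙 x true  j = begin
  (x + 1) C suc j           ≡⟨ cong (_C suc j) (+-comm x 1) ⟩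
  suc x C suc j             ≡⟨ C-pascal x j ⟩
  x C j + x C suc j         ≡⟨ +-comm (x C j) (x C suc j) ⟩
  x C suc j + x C j         ≡⟨ cong (x C suc j +_) (sym (*-identityˡ (x C j))) ⟩
  x C suc j + 1 * (x C j)   ∎
  where open ≡-Reasoning

record Finite (A : Set) : Set where
  field
    size  : ℕ
    index : A ↔ Fin size
open Finite public

∑ᶠ : ∀ {A} → Finite A → (A → ℕ) → ℕ
∑ᶠ fin g = ∑[ i < size fin ] g (Inverse.from (index fin) i)

∑ᶠ-cong : ∀ {A} (fin : Finite A) {g h : A → ℕ} → (∀ a → g a ≡ h a) → ∑ᶠ fin g ≡ ∑ᶠ fin h
∑ᶠ-cong fin g≗h = sum-cong-≗ {size fin} (λ i → g≗h (Inverse.from (index fin) i))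

∑ᶠ-↔ : ∀ {A B} (finA : Finite A) (finB : Finite B) (ψ : A ↔ B) {g : A → ℕ} {h : B → ℕ} →
  (∀ a → g a ≡ h (Inverse.to ψ a)) → ∑ᶠ finA g ≡ ∑ᶠ finB h
∑ᶠ-↔ finA finB ψ {g} {h} g≡h∘ψ = begin
  ∑ᶠ finA g
    ≡⟨ ∑ᶠ-cong finA (λ a → trans (g≡h∘ψ a) (cong h (sym (Inverse.strictlyInverseʳ (index finB) _)))) ⟩
  ∑[ i < size finA ] h′ (Inverse.to π i)
    ≡⟨ ∑-reindex π h′ ⟩
  ∑ᶠ finB h
    ∎
  where
  open ≡-Reasoning
  π = ↔-trans (↔-sym (index finA)) (↔-trans ψ (index finB))
  h′ = h ∘ Inverse.from (index finB)

∑ᶠ-ones : ∀ {A} (fin : Finite A) → ∑ᶠ fin (λ _ → 1) ≡ size fin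
∑ᶠ-ones fin = ∑-ones (size fin)


finite-↔ : ∀ {A B} → Finite A → A ↔ B → Finite B
finite-↔ fin ψ = record { size = size fin ; index = ↔-trans (↔-sym ψ) (index fin) }

⊎-↔ : ∀ {A B C D : Set} → A ↔ C → B ↔ D → (A ⊎ B) ↔ (C ⊎ D)
⊎-↔ f g = mk↔ₛ′ (Sum.map (Inverse.to f) (Inverse.to g)) (Sum.map (Inverse.from f) (Inverse.from g))
  (λ { (inj₁ c) → cong inj₁ (Inverse.strictlyInverseˡ f c) ; (inj₂ d) → cong inj₂ (Inverse.strictlyInverseˡ g d) })
  (λ { (inj₁ a) → cong inj₁ (Inverse.strictlyInverseʳ f a) ; (inj₂ b) → cong inj₂ (Inverse.strictlyInverseʳ g b) })

finite-⊎ : ∀ {A B} → Finite A → Finite B → Finite (A ⊎ B)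
finite-⊎ finA finB = record
  { size  = size finA + size finB
  ; index = ↔-trans (⊎-↔ (index finA) (index finB)) (↔-sym +↔⊎) }

∑ᶠ-⊎ : ∀ {A B} (finA : Finite A) (finB : Finite B) (g : A ⊎ B → ℕ) →
  ∑ᶠ (finite-⊎ finA finB) g ≡ ∑ᶠ finA (g ∘ inj₁) + ∑ᶠ finB (g ∘ inj₂)
∑ᶠ-⊎ finA finB g = trans (∑-split (size finA) (size finB) _)
  (cong₂ _+_ (sum-cong-≗ (λ i → cong g′ (splitAt-↑ˡ (size finA) i (size finB))))
             (sum-cong-≗ (λ i → cong g′ (splitAt-↑ʳ (size finA) (size finB) i))))
  where g′ = g ∘ Sum.map (Inverse.from (index finA)) (Inverse.from (index finB))

finite-Dec : ∀ {P : Set} → Dec P → Irrelevant P → Finite P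
finite-Dec (yes p) irr = record { size = 1 ; index = mk↔ₛ′ (λ _ → zero) (λ _ → p) (λ { zero → refl }) (irr p) }
finite-Dec (no ¬p) irr = record { size = 0 ; index = mk↔ₛ′ (⊥-elim ∘ ¬p) (λ ()) (λ ()) (⊥-elim ∘ ¬p) }

∑ᶠ-Dec : ∀ {P : Set} (P? : Dec P) (irr : Irrelevant P) c → ∑ᶠ (finite-Dec P? irr) (λ _ → c) ≡ 𝟙 (does P?) * c
∑ᶠ-Dec (yes p) irr c = refl
∑ᶠ-Dec (no ¬p) irr c = refl

Σ-Fin-suc-↔ : ∀ {m} (P : Fin (suc m) → Set) → (P zero ⊎ Σ (Fin m) (P ∘ suc)) ↔ Σ (Fin (suc m)) P
Σ-Fin-suc-↔ {m} P = mk↔ₛ′ join split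
  (λ { (zero , p) → refl ; (suc i , p) → refl }) (λ { (inj₁ p) → refl ; (inj₂ (i , p)) → refl })
  where
  join : P zero ⊎ Σ (Fin m) (P ∘ suc) → Σ (Fin (suc m)) P
  join (inj₁ p)       = zero , p
  join (inj₂ (i , p)) = suc i , p
  split : Σ (Fin (suc m)) P → P zero ⊎ Σ (Fin m) (P ∘ suc)
  split (zero  , p) = inj₁ p
  split (suc i , p) = inj₂ (i , p)

finite-ΣFin : ∀ m (P : Fin m → Set) → (∀ i → Dec (P i)) → (∀ i → Irrelevant (P i)) → Finite (Σ (Fin m) P)
finite-ΣFin zero    P P? irr = record { size = 0 ; index = mk↔ₛ′ (λ ()) (λ ()) (λ ()) (λ ()) }
finite-ΣFin (suc m) P P? irr = finite-↔
  (finite-⊎ (finite-Dec (P? zero) (irr zero)) (finite-ΣFin m (P ∘ suc) (P? ∘ suc) (irr ∘ suc)))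
  (Σ-Fin-suc-↔ P)

∑ᶠ-ΣFin : ∀ m (P : Fin m → Set) (P? : ∀ i → Dec (P i)) (irr : ∀ i → Irrelevant (P i)) (g : Fin m → ℕ) →
  ∑ᶠ (finite-ΣFin m P P? irr) (g ∘ proj₁) ≡ ∑[ i < m ] (𝟙 (does (P? i)) * g i)
∑ᶠ-ΣFin zero    P P? irr g = refl
∑ᶠ-ΣFin (suc m) P P? irr g = trans
  (∑ᶠ-⊎ (finite-Dec (P? zero) (irr zero)) (finite-ΣFin m (P ∘ suc) (P? ∘ suc) (irr ∘ suc))
        (g ∘ proj₁ ∘ Inverse.to (Σ-Fin-suc-↔ P)))
  (cong₂ _+_ (∑ᶠ-Dec (P? zero) (irr zero) (g zero)) (∑ᶠ-ΣFin m (P ∘ suc) (P? ∘ suc) (irr ∘ suc) (g ∘ suc)))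

Σ-≡-irrelevant : ∀ {A : Set} {P : A → Set} → (∀ a → Irrelevant (P a)) →
  ∀ {a b} {p : P a} {q : P b} → a ≡ b → (a , p) ≡ (b , q)
Σ-≡-irrelevant irr {a} {p = p} {q} refl = cong (a ,_) (irr a p q)

Σ-reindex-↔ : ∀ {A B : Set} (P : A → Set) → (∀ a → Irrelevant (P a)) → (ψ : B ↔ A) →
  Σ B (P ∘ Inverse.to ψ) ↔ Σ A P
Σ-reindex-↔ P irr ψ = mk↔ₛ′
  (λ { (b , p) → Inverse.to ψ b , p })
  (λ { (a , p) → Inverse.from ψ a , subst P (sym (Inverse.strictlyInverseˡ ψ a)) p })
  (λ { (a , p) → Σ-≡-irrelevant irr (Inverse.strictlyInverseˡ ψ a) })
  (λ { (b , p) → Σ-≡-irrelevant (irr ∘ Inverse.to ψ) (Inverse.strictlyInverseʳ ψ b) })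

finite-Σ : ∀ {A : Set} {P : A → Set} → Finite A → (∀ a → Dec (P a)) → (∀ a → Irrelevant (P a)) → Finite (Σ A P)
finite-Σ {P = P} fin P? irr = finite-↔
  (finite-ΣFin (size fin) (P ∘ from) (P? ∘ from) (irr ∘ from))
  (Σ-reindex-↔ P irr (↔-sym (index fin)))
  where from = Inverse.from (index fin)

∑ᶠ-Σ : ∀ {A : Set} {P : A → Set} (fin : Finite A) (P? : ∀ a → Dec (P a)) (irr : ∀ a → Irrelevant (P a))
  (g : A → ℕ) → ∑ᶠ (finite-Σ fin P? irr) (g ∘ proj₁) ≡ ∑ᶠ fin (λ a → 𝟙 (does (P? a)) * g a)
∑ᶠ-Σ fin P? irr g = ∑ᶠ-ΣFin (size fin) _ (P? ∘ from) (irr ∘ from) (g ∘ from)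
  where from = Inverse.from (index fin)

∑ᶠ-+ : ∀ {A} (fin : Finite A) (f g : A → ℕ) → ∑ᶠ fin (λ a → f a + g a) ≡ ∑ᶠ fin f + ∑ᶠ fin g
∑ᶠ-+ fin f g = ∑-distrib-+ (f ∘ Inverse.from (index fin)) (g ∘ Inverse.from (index fin))

∑ᶠ-zero : ∀ {A} (fin : Finite A) → ∑ᶠ fin (λ _ → 0) ≡ 0
∑ᶠ-zero fin = sum-replicate-zero (size fin)

-- Sums over subsets

Subset-suc-↔ : ∀ {n} → (Subset n ⊎ Subset n) ↔ Subset (suc n)
Subset-suc-↔ {n} = mk↔ₛ′ join split
  (λ { (outside ∷ S) → refl ; (inside ∷ S) → refl }) (λ { (inj₁ S) → refl ; (inj₂ S) → refl })
  where
  join : Subset n ⊎ Subset n → Subset (suc n)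
  join (inj₁ S) = outside ∷ S
  join (inj₂ S) = inside ∷ S
  split : Subset (suc n) → Subset n ⊎ Subset n
  split (outside ∷ S) = inj₁ S
  split (inside  ∷ S) = inj₂ S

finite-Subset : ∀ n → Finite (Subset n)
finite-Subset zero    = record { size = 1 ; index = mk↔ₛ′ (λ _ → zero) (λ _ → []) (λ { zero → refl }) (λ { [] → refl }) }
finite-Subset (suc n) = finite-↔ (finite-⊎ (finite-Subset n) (finite-Subset n)) Subset-suc-↔

∑ˢ : ∀ {n} → (Subset n → ℕ) → ℕ
∑ˢ {n} = ∑ᶠ (finite-Subset n)


∑ˢ-∷ : ∀ {n} (g : Subset (suc n) → ℕ) → ∑ˢ g ≡ ∑ˢ (g ∘ (outside ∷_)) + ∑ˢ (g ∘ (inside ∷_))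
∑ˢ-∷ {n} g = ∑ᶠ-⊎ (finite-Subset n) (finite-Subset n) (g ∘ Inverse.to Subset-suc-↔)

subsetMoment : ∀ {n} → Subset n → ℕ → ℕ → ℕ
subsetMoment A j m = ∑ˢ (λ S → ⟦ ∣ S ∣ ≟ m ⟧ * (∣ S ∩ A ∣ C j))

subsetMoment-small : ∀ {n} (A : Subset n) {j m} → m < j → subsetMoment A j m ≡ 0
subsetMoment-small {n} A {j} {m} m<j = trans (∑ᶠ-cong (finite-Subset n) (λ S → ⟦⟧*-vanish (∣ S ∣ ≟ m) (too-few S)))
                                             (∑ᶠ-zero (finite-Subset n))
  where
  too-few : ∀ S → ∣ S ∣ ≡ m → ∣ S ∩ A ∣ C j ≡ 0
  too-few S ∣S∣≡m = k>n⇒nCk≡0 (≤-<-trans (p⊆q⇒∣p∣≤∣q∣ (p∩q⊆p S A)) (subst (_< j) (sym ∣S∣≡m) m<j))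

subsetMoment-∷-zero : ∀ {n} c (A : Subset n) j → subsetMoment (c ∷ A) j 0 ≡ subsetMoment A j 0
subsetMoment-∷-zero {n} c A j =
  trans (∑ˢ-∷ (λ S → ⟦ ∣ S ∣ ≟ 0 ⟧ * (∣ S ∩ (c ∷ A) ∣ C j)))
        (trans (cong (subsetMoment A j 0 +_) (∑ᶠ-zero (finite-Subset n))) (+-identityʳ _))

subsetMoment-∷-C0 : ∀ {n} c (A : Subset n) m → subsetMoment (c ∷ A) 0 (suc m) ≡ subsetMoment A 0 (suc m) + subsetMoment A 0 m
subsetMoment-∷-C0 {n} c A m = trans (∑ˢ-∷ (λ S → ⟦ ∣ S ∣ ≟ suc m ⟧ * (∣ S ∩ (c ∷ A) ∣ C 0)))
  (cong (subsetMoment A 0 (suc m) +_)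
        (∑ᶠ-cong (finite-Subset n) (λ S → cong (⟦ ∣ S ∣ ≟ m ⟧ *_) (C-zeroʳ-≡ ∣ c ∷ (S ∩ A) ∣ ∣ S ∩ A ∣))))

subsetMoment-outside : ∀ {n} (A : Subset n) j m →
  subsetMoment (outside ∷ A) j (suc m) ≡ subsetMoment A j (suc m) + subsetMoment A j m
subsetMoment-outside A j m = ∑ˢ-∷ (λ S → ⟦ ∣ S ∣ ≟ suc m ⟧ * (∣ S ∩ (outside ∷ A) ∣ C j))

subsetMoment-inside : ∀ {n} (A : Subset n) j m →
  subsetMoment (inside ∷ A) (suc j) (suc m) ≡ subsetMoment (outside ∷ A) (suc j) (suc m) + subsetMoment A j m
subsetMoment-inside {n} A j m = begin
  subsetMoment (inside ∷ A) (suc j) (suc m)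
    ≡⟨ ∑ˢ-∷ (λ S → ⟦ ∣ S ∣ ≟ suc m ⟧ * (∣ S ∩ (inside ∷ A) ∣ C suc j)) ⟩
  subsetMoment A (suc j) (suc m) + ∑ˢ (λ S → ⟦ ∣ S ∣ ≟ m ⟧ * (suc ∣ S ∩ A ∣ C suc j))
    ≡⟨ cong (subsetMoment A (suc j) (suc m) +_) pascal ⟩
  subsetMoment A (suc j) (suc m) + (subsetMoment A j m + subsetMoment A (suc j) m)
    ≡⟨ cong (subsetMoment A (suc j) (suc m) +_) (+-comm (subsetMoment A j m) _) ⟩
  subsetMoment A (suc j) (suc m) + (subsetMoment A (suc j) m + subsetMoment A j m)
    ≡⟨ sym (+-assoc (subsetMoment A (suc j) (suc m)) _ _) ⟩
  subsetMoment A (suc j) (suc m) + subsetMoment A (suc j) m + subsetMoment A j m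
    ≡⟨ cong (_+ subsetMoment A j m) (sym (subsetMoment-outside A (suc j) m)) ⟩
  subsetMoment (outside ∷ A) (suc j) (suc m) + subsetMoment A j m
    ∎
  where
  open ≡-Reasoning
  pascal : ∑ˢ (λ S → ⟦ ∣ S ∣ ≟ m ⟧ * (suc ∣ S ∩ A ∣ C suc j)) ≡ subsetMoment A j m + subsetMoment A (suc j) m
  pascal = trans (∑ᶠ-cong (finite-Subset n) (λ S → trans (cong (⟦ ∣ S ∣ ≟ m ⟧ *_) (C-pascal ∣ S ∩ A ∣ j))
                                                        (*-distribˡ-+ ⟦ ∣ S ∣ ≟ m ⟧ (∣ S ∩ A ∣ C j) (∣ S ∩ A ∣ C suc j))))
                 (∑ᶠ-+ (finite-Subset n) (λ S → ⟦ ∣ S ∣ ≟ m ⟧ * (∣ S ∩ A ∣ C j))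
                                         (λ S → ⟦ ∣ S ∣ ≟ m ⟧ * (∣ S ∩ A ∣ C suc j)))

C*-pascal-∸ : ∀ a n j r → a ≤ n →
  (a C suc j) * ((n ∸ suc j) C suc r) + (a C suc j) * ((n ∸ suc j) C r) ≡ (a C suc j) * ((n ∸ j) C suc r)
C*-pascal-∸ a n j r a≤n with j <? n
... | yes j<n = begin
  b * ((n ∸ suc j) C suc r) + b * ((n ∸ suc j) C r)   ≡⟨ sym (*-distribˡ-+ b _ _) ⟩
  b * ((n ∸ suc j) C suc r + (n ∸ suc j) C r)         ≡⟨ cong (b *_) (+-comm ((n ∸ suc j) C suc r) _) ⟩
  b * ((n ∸ suc j) C r + (n ∸ suc j) C suc r)         ≡⟨ cong (b *_) (sym (C-pascal (n ∸ suc j) r)) ⟩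
  b * (suc (n ∸ suc j) C suc r)                       ≡⟨ cong (λ m → b * (m C suc r)) (sym (+-∸-assoc 1 j<n)) ⟩
  b * ((n ∸ j) C suc r)                               ∎
  where
  open ≡-Reasoning
  b = a C suc j
... | no j≮n rewrite k>n⇒nCk≡0 {a} {suc j} (s≤s (≤-trans a≤n (≮⇒≥ j≮n))) = refl

mutual
  subsetMoment≡ : ∀ {n} (A : Subset n) j r → subsetMoment A j (j + r) ≡ (∣ A ∣ C j) * ((n ∸ j) C r)
  subsetMoment≡ [] zero    zero    = refl
  subsetMoment≡ [] zero    (suc r) = refl
  subsetMoment≡ [] (suc j) r       = refl
  subsetMoment≡ {suc n} (c ∷ A) zero zero = begin
    subsetMoment (c ∷ A) 0 0       ≡⟨ subsetMoment-∷-zero c A 0 ⟩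
    subsetMoment A 0 0             ≡⟨ subsetMoment≡ A 0 0 ⟩
    (∣ A ∣ C 0) * (n C 0)          ≡⟨ cong₂ _*_ (C-zeroʳ-≡ ∣ A ∣ ∣ c ∷ A ∣) (C-zeroʳ-≡ n (suc n)) ⟩
    (∣ c ∷ A ∣ C 0) * (suc n C 0)  ∎
    where open ≡-Reasoning
  subsetMoment≡ {suc n} (c ∷ A) zero (suc r) = begin
    subsetMoment (c ∷ A) 0 (suc r)                      ≡⟨ subsetMoment-∷-C0 c A r ⟩
    subsetMoment A 0 (suc r) + subsetMoment A 0 r       ≡⟨ cong₂ _+_ (subsetMoment≡ A 0 (suc r)) (subsetMoment≡ A 0 r) ⟩
    (∣ A ∣ C 0) * (n C suc r) + (∣ A ∣ C 0) * (n C r)   ≡⟨ sym (*-distribˡ-+ (∣ A ∣ C 0) (n C suc r) (n C r)) ⟩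
    (∣ A ∣ C 0) * (n C suc r + n C r)                   ≡⟨ cong₂ _*_ (C-zeroʳ-≡ ∣ A ∣ ∣ c ∷ A ∣)
                                                                      (trans (+-comm (n C suc r) (n C r)) (sym (C-pascal n r))) ⟩
    (∣ c ∷ A ∣ C 0) * (suc n C suc r)                   ∎
    where open ≡-Reasoning
  subsetMoment≡ (outside ∷ A) (suc j) r = subsetMoment-outside≡ A j r
  subsetMoment≡ {suc n} (inside ∷ A) (suc j) r = begin
    subsetMoment (inside ∷ A) (suc j) (suc j + r)
      ≡⟨ subsetMoment-inside A j (j + r) ⟩
    subsetMoment (outside ∷ A) (suc j) (suc j + r) + subsetMoment A j (j + r)
      ≡⟨ cong₂ _+_ (subsetMoment-outside≡ A j r) (subsetMoment≡ A j r) ⟩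
    (∣ A ∣ C suc j) * K + (∣ A ∣ C j) * K
      ≡⟨ sym (*-distribʳ-+ K (∣ A ∣ C suc j) (∣ A ∣ C j)) ⟩
    (∣ A ∣ C suc j + ∣ A ∣ C j) * K
      ≡⟨ cong (_* K) (trans (+-comm (∣ A ∣ C suc j) (∣ A ∣ C j)) (sym (C-pascal ∣ A ∣ j))) ⟩
    (suc ∣ A ∣ C suc j) * K
      ∎
    where
    open ≡-Reasoning
    K = (n ∸ j) C r

  subsetMoment-outside≡ : ∀ {n} (A : Subset n) j r →
    subsetMoment (outside ∷ A) (suc j) (suc j + r) ≡ (∣ A ∣ C suc j) * ((n ∸ j) C r)
  subsetMoment-outside≡ {n} A j zero = begin
    subsetMoment (outside ∷ A) (suc j) (suc j + 0)               ≡⟨ subsetMoment-outside A (suc j) (j + 0) ⟩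
    subsetMoment A (suc j) (suc j + 0) + subsetMoment A (suc j) (j + 0)
      ≡⟨ cong₂ _+_ (subsetMoment≡ A (suc j) 0) (subsetMoment-small A (s≤s (≤-reflexive (+-identityʳ j)))) ⟩
    (∣ A ∣ C suc j) * ((n ∸ suc j) C 0) + 0                      ≡⟨ +-identityʳ _ ⟩
    (∣ A ∣ C suc j) * ((n ∸ suc j) C 0)                          ≡⟨ cong ((∣ A ∣ C suc j) *_) (C-zeroʳ-≡ (n ∸ suc j) (n ∸ j)) ⟩
    (∣ A ∣ C suc j) * ((n ∸ j) C 0)                              ∎
    where open ≡-Reasoning
  subsetMoment-outside≡ {n} A j (suc r) = begin
    subsetMoment (outside ∷ A) (suc j) (suc j + suc r)
      ≡⟨ subsetMoment-outside A (suc j) (j + suc r) ⟩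
    subsetMoment A (suc j) (suc j + suc r) + subsetMoment A (suc j) (j + suc r)
      ≡⟨ cong (λ m → subsetMoment A (suc j) (suc j + suc r) + subsetMoment A (suc j) m) (+-suc j r) ⟩
    subsetMoment A (suc j) (suc j + suc r) + subsetMoment A (suc j) (suc j + r)
      ≡⟨ cong₂ _+_ (subsetMoment≡ A (suc j) (suc r)) (subsetMoment≡ A (suc j) r) ⟩
    (∣ A ∣ C suc j) * ((n ∸ suc j) C suc r) + (∣ A ∣ C suc j) * ((n ∸ suc j) C r)
      ≡⟨ C*-pascal-∸ ∣ A ∣ n j r (∣p∣≤n A) ⟩
    (∣ A ∣ C suc j) * ((n ∸ j) C suc r)
      ∎
    where open ≡-Reasoning

∣∷∣ : ∀ {n} b (S : Subset n) → ∣ b ∷ S ∣ ≡ 𝟙 b + ∣ S ∣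
∣∷∣ outside S = refl
∣∷∣ inside  S = refl

∣∩∪⁅⁆∣ : ∀ {n} (S A : Subset n) {v} → v ∉ A → ∣ S ∩ (A ∪ ⁅ v ⁆) ∣ ≡ ∣ S ∩ A ∣ + ⟦ v ∈? S ⟧
∣∩∪⁅⁆∣ (s ∷ S) (inside ∷ A) {zero} v∉A = ⊥-elim (v∉A here)
∣∩∪⁅⁆∣ (inside ∷ S) (outside ∷ A) {zero} v∉A =
  trans (cong (λ X → suc ∣ S ∩ X ∣) (∪-identityʳ A)) (+-comm 1 ∣ S ∩ A ∣)
∣∩∪⁅⁆∣ (outside ∷ S) (outside ∷ A) {zero} v∉A = trans (cong (λ X → ∣ S ∩ X ∣) (∪-identityʳ A)) (sym (+-identityʳ _))
∣∩∪⁅⁆∣ (s ∷ S) (a ∷ A) {suc v} v∉A = begin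
  ∣ (s ∧ (a ∨ outside)) ∷ (S ∩ (A ∪ ⁅ v ⁆)) ∣      ≡⟨ ∣∷∣ (s ∧ (a ∨ outside)) (S ∩ (A ∪ ⁅ v ⁆)) ⟩
  𝟙 (s ∧ (a ∨ outside)) + ∣ S ∩ (A ∪ ⁅ v ⁆) ∣
    ≡⟨ cong₂ (λ b m → 𝟙 (s ∧ b) + m) (∨-identityʳ a) (∣∩∪⁅⁆∣ S A (v∉A ∘ there)) ⟩
  𝟙 (s ∧ a) + (∣ S ∩ A ∣ + ⟦ v ∈? S ⟧)             ≡⟨ sym (+-assoc (𝟙 (s ∧ a)) _ _) ⟩
  𝟙 (s ∧ a) + ∣ S ∩ A ∣ + ⟦ v ∈? S ⟧               ≡⟨ cong (_+ ⟦ v ∈? S ⟧) (sym (∣∷∣ (s ∧ a) (S ∩ A))) ⟩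
  ∣ (s ∧ a) ∷ (S ∩ A) ∣ + ⟦ v ∈? S ⟧               ∎
  where open ≡-Reasoning

∣∪⁅⁆∣ : ∀ {n} (A : Subset n) {v} → v ∉ A → ∣ A ∪ ⁅ v ⁆ ∣ ≡ suc ∣ A ∣
∣∪⁅⁆∣ A {v} v∉A = begin
  ∣ A ∪ ⁅ v ⁆ ∣              ≡⟨ cong ∣_∣ (sym (∩-identityˡ (A ∪ ⁅ v ⁆))) ⟩
  ∣ ⊤ ∩ (A ∪ ⁅ v ⁆) ∣        ≡⟨ ∣∩∪⁅⁆∣ ⊤ A v∉A ⟩
  ∣ ⊤ ∩ A ∣ + ⟦ v ∈? ⊤ ⟧     ≡⟨ cong₂ _+_ (cong ∣_∣ (∩-identityˡ A)) (⟦⟧-yes (v ∈? ⊤) ∈⊤) ⟩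
  ∣ A ∣ + 1                  ≡⟨ +-comm ∣ A ∣ 1 ⟩
  suc ∣ A ∣                  ∎
  where open ≡-Reasoning

-- By Pascal's rule, |S ∩ (A ∪ ⁅ v ⁆)| = |S ∩ A| + [v ∈ S] turns this sum into the difference
-- of two instances of subsetMoment≡.

subsetMoment-∈≡ : ∀ {n} (A : Subset n) {v} → v ∉ A → ∀ j r →
  ∑ˢ (λ S → ⟦ ∣ S ∣ ≟ suc j + r ⟧ * (⟦ v ∈? S ⟧ * (∣ S ∩ A ∣ C j))) ≡ (∣ A ∣ C j) * ((n ∸ suc j) C r)
subsetMoment-∈≡ {n} A {v} v∉A j r = +-cancelˡ-≡ (∑ˢ B) _ _ (begin
  ∑ˢ B + ∑ˢ P                                          ≡⟨ sym (∑ᶠ-+ (finite-Subset n) B P) ⟩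
  ∑ˢ (λ S → B S + P S)                                 ≡⟨ ∑ᶠ-cong (finite-Subset n) split ⟩
  subsetMoment A′ (suc j) (suc j + r)                  ≡⟨ subsetMoment≡ A′ (suc j) r ⟩
  (∣ A′ ∣ C suc j) * K                                  ≡⟨ cong (λ m → (m C suc j) * K) (∣∪⁅⁆∣ A v∉A) ⟩
  (suc ∣ A ∣ C suc j) * K                               ≡⟨ cong (_* K) (trans (C-pascal ∣ A ∣ j) (+-comm (∣ A ∣ C j) _)) ⟩
  (∣ A ∣ C suc j + ∣ A ∣ C j) * K                       ≡⟨ *-distribʳ-+ K (∣ A ∣ C suc j) (∣ A ∣ C j) ⟩
  (∣ A ∣ C suc j) * K + (∣ A ∣ C j) * K                 ≡⟨ cong (_+ (∣ A ∣ C j) * K) (sym (subsetMoment≡ A (suc j) r)) ⟩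
  ∑ˢ B + (∣ A ∣ C j) * K                                ∎)
  where
  open ≡-Reasoning
  A′ = A ∪ ⁅ v ⁆
  K = (n ∸ suc j) C r
  B P : Subset n → ℕ
  B S = ⟦ ∣ S ∣ ≟ suc j + r ⟧ * (∣ S ∩ A ∣ C suc j)
  P S = ⟦ ∣ S ∣ ≟ suc j + r ⟧ * (⟦ v ∈? S ⟧ * (∣ S ∩ A ∣ C j))
  split : ∀ S → B S + P S ≡ ⟦ ∣ S ∣ ≟ suc j + r ⟧ * (∣ S ∩ A′ ∣ C suc j)
  split S = begin
    B S + P S
      ≡⟨ sym (*-distribˡ-+ ⟦ ∣ S ∣ ≟ suc j + r ⟧ (∣ S ∩ A ∣ C suc j) _) ⟩
    ⟦ ∣ S ∣ ≟ suc j + r ⟧ * (∣ S ∩ A ∣ C suc j + ⟦ v ∈? S ⟧ * (∣ S ∩ A ∣ C j))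
      ≡⟨ cong (⟦ ∣ S ∣ ≟ suc j + r ⟧ *_) (sym (C-+𝟙 ∣ S ∩ A ∣ (does (v ∈? S)) j)) ⟩
    ⟦ ∣ S ∣ ≟ suc j + r ⟧ * ((∣ S ∩ A ∣ + ⟦ v ∈? S ⟧) C suc j)
      ≡⟨ cong (λ m → ⟦ ∣ S ∣ ≟ suc j + r ⟧ * (m C suc j)) (sym (∣∩∪⁅⁆∣ S A v∉A)) ⟩
    ⟦ ∣ S ∣ ≟ suc j + r ⟧ * (∣ S ∩ A′ ∣ C suc j)
      ∎

-- Binomial moments

moment : ∀ {n} → (Fin n → ℕ) → ℕ → ℕ
moment {n} x j = ∑[ v < n ] (x v C j)

multiplicity : ∀ {n} → (Fin n → ℕ) → ℕ → ℕ
multiplicity {n} x d = ∑[ v < n ] ⟦ x v ≟ d ⟧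

multiplicity-beyond : ∀ {n} (x : Fin n → ℕ) {B d} → (∀ v → x v ≤ B) → B < d → multiplicity x d ≡ 0
multiplicity-beyond x x≤B B<d = ∑-zero _ (λ v → ⟦⟧-no (x v ≟ _) (λ x≡d → <⇒≱ B<d (subst (_≤ _) x≡d (x≤B v))))

value-as-∑ : ∀ B (g : ℕ → ℕ) {a} → a ≤ B → g a ≡ ∑[ e < suc B ] (⟦ a ≟ toℕ e ⟧ * g (toℕ e))
value-as-∑ B g {a} a≤B = sym (trans (∑-single f i others) at-a)
  where
  f = λ (e : Fin (suc B)) → ⟦ a ≟ toℕ e ⟧ * g (toℕ e)
  i = fromℕ< (s≤s a≤B)
  others : ∀ e → e ≢ i → f e ≡ 0
  others e e≢i = ⟦⟧*-vanish (a ≟ toℕ e) (λ a≡e → ⊥-elim (e≢i (toℕ-injective (trans (sym a≡e) (sym (toℕ-fromℕ< (s≤s a≤B)))))))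
  at-a : f i ≡ g a
  at-a = trans (cong (λ m → ⟦ a ≟ m ⟧ * g m) (toℕ-fromℕ< (s≤s a≤B)))
               (trans (cong (_* g a) (⟦⟧-yes (a ≟ a) refl)) (+-identityʳ (g a)))

∑-by-value : ∀ {n} (x : Fin n → ℕ) B → (∀ v → x v ≤ B) → (g : ℕ → ℕ) →
  ∑[ v < n ] g (x v) ≡ ∑[ e < suc B ] (multiplicity x (toℕ e) * g (toℕ e))
∑-by-value {n} x B x≤B g = begin
  ∑[ v < n ] g (x v)
    ≡⟨ sum-cong-≗ {n} (λ v → value-as-∑ B g {x v} (x≤B v)) ⟩
  ∑[ v < n ] ∑[ e < suc B ] (⟦ x v ≟ toℕ e ⟧ * g (toℕ e))
    ≡⟨ ∑-comm {n} {suc B} (λ v e → ⟦ x v ≟ toℕ e ⟧ * g (toℕ e)) ⟩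
  ∑[ e < suc B ] ∑[ v < n ] (⟦ x v ≟ toℕ e ⟧ * g (toℕ e))
    ≡⟨ sum-cong-≗ {suc B} (λ e → sym (*-distribʳ-sum (g (toℕ e)) (λ v → ⟦ x v ≟ toℕ e ⟧))) ⟩
  ∑[ e < suc B ] (multiplicity x (toℕ e) * g (toℕ e))
    ∎
  where open ≡-Reasoning

-- the d-th binomial moment counts the value d once and every larger value e exactly C(e, d) times
multiplicity-from-moment : ∀ {n} (x y : Fin n → ℕ) B → (∀ v → x v ≤ B) → (∀ v → y v ≤ B) → ∀ d →
  moment x d ≡ moment y d → (∀ e → d < e → multiplicity x e ≡ multiplicity y e) → multiplicity x d ≡ multiplicity y d
multiplicity-from-moment {n} x y B x≤B y≤B d moment≡ above with d ≤? B
... | no d≰B = trans (multiplicity-beyond x x≤B (≰⇒> d≰B)) (sym (multiplicity-beyond y y≤B (≰⇒> d≰B)))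
... | yes d≤B = begin
  multiplicity x d             ≡⟨ sym (*-identityʳ _) ⟩
  multiplicity x d * 1         ≡⟨ cong (multiplicity x d *_) (sym (nCn≡1 d)) ⟩
  multiplicity x d * (d C d)   ≡⟨ subst (λ m → F x m ≡ F y m) (toℕ-fromℕ< (s≤s d≤B)) (∑-cancel-single _ _ i others sums) ⟩
  multiplicity y d * (d C d)   ≡⟨ cong (multiplicity y d *_) (nCn≡1 d) ⟩
  multiplicity y d * 1         ≡⟨ *-identityʳ _ ⟩
  multiplicity y d             ∎
  where
  open ≡-Reasoning
  F : (Fin n → ℕ) → ℕ → ℕ
  F z e = multiplicity z e * (e C d)
  i = fromℕ< (s≤s d≤B)
  sums : ∑[ e < suc B ] F x (toℕ e) ≡ ∑[ e < suc B ] F y (toℕ e)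
  sums = trans (sym (∑-by-value x B x≤B (_C d))) (trans moment≡ (∑-by-value y B y≤B (_C d)))
  others : ∀ e → e ≢ i → F x (toℕ e) ≡ F y (toℕ e)
  others e e≢i with <-cmp (toℕ e) d
  ... | tri< e<d _ _ = begin
    multiplicity x (toℕ e) * (toℕ e C d)   ≡⟨ cong (multiplicity x (toℕ e) *_) (k>n⇒nCk≡0 e<d) ⟩
    multiplicity x (toℕ e) * 0             ≡⟨ *-zeroʳ (multiplicity x (toℕ e)) ⟩
    0                                      ≡⟨ sym (*-zeroʳ (multiplicity y (toℕ e))) ⟩
    multiplicity y (toℕ e) * 0             ≡⟨ cong (multiplicity y (toℕ e) *_) (sym (k>n⇒nCk≡0 e<d)) ⟩
    multiplicity y (toℕ e) * (toℕ e C d)   ∎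
  ... | tri≈ _ e≡d _ = ⊥-elim (e≢i (toℕ-injective (trans e≡d (sym (toℕ-fromℕ< (s≤s d≤B))))))
  ... | tri> _ _ d<e = cong (_* (toℕ e C d)) (above (toℕ e) d<e)

moments⇒multiplicities : ∀ {n} (x y : Fin n → ℕ) B → (∀ v → x v ≤ B) → (∀ v → y v ≤ B) →
  (∀ j → moment x j ≡ moment y j) → ∀ d → multiplicity x d ≡ multiplicity y d
moments⇒multiplicities x y B x≤B y≤B moment≡ d = downwards (suc B) d (≤-trans (s≤s (m≤n+m B d)) (≤-reflexive (sym (+-suc d B))))
  where
  downwards : ∀ t d → B < d + t → multiplicity x d ≡ multiplicity y d
  downwards zero d B<d+0 = trans (multiplicity-beyond x x≤B B<d) (sym (multiplicity-beyond y y≤B B<d))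
    where B<d = subst (B <_) (+-identityʳ d) B<d+0
  downwards (suc t) d B<d+1+t = multiplicity-from-moment x y B x≤B y≤B d (moment≡ d)
    (λ e d<e → downwards t e (≤-trans B<d+1+t (≤-trans (≤-reflexive (+-suc d t)) (+-monoˡ-≤ t d<e))))

fibre : ∀ {n} → (Fin n → ℕ) → ℕ → Set
fibre {n} x d = Σ (Fin n) (λ v → x v ≡ d)

finite-fibre : ∀ {n} (x : Fin n → ℕ) d → Finite (fibre x d)
finite-fibre {n} x d = finite-ΣFin n (λ v → x v ≡ d) (λ v → x v ≟ d) (λ _ → ≡-irrelevant)

size-fibre : ∀ {n} (x : Fin n → ℕ) d → size (finite-fibre x d) ≡ multiplicity x d
size-fibre {n} x d = begin
  size (finite-fibre x d)                    ≡⟨ sym (∑ᶠ-ones (finite-fibre x d)) ⟩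
  ∑ᶠ (finite-fibre x d) (λ _ → 1)
    ≡⟨ ∑ᶠ-ΣFin n (λ v → x v ≡ d) (λ v → x v ≟ d) (λ _ → ≡-irrelevant) (λ _ → 1) ⟩
  ∑[ v < n ] (⟦ x v ≟ d ⟧ * 1)               ≡⟨ sum-cong-≗ {n} (λ v → *-identityʳ ⟦ x v ≟ d ⟧) ⟩
  multiplicity x d                           ∎
  where open ≡-Reasoning

Fin-↔-fibres : ∀ {n} (x : Fin n → ℕ) → Fin n ↔ Σ ℕ (fibre x)
Fin-↔-fibres x = mk↔ₛ′ (λ v → x v , v , refl) (λ (_ , v , _) → v) (λ { (_ , v , refl) → refl }) (λ _ → refl)

Fin-↔-≡ : ∀ {a b} → a ≡ b → Fin a ↔ Fin b
Fin-↔-≡ refl = ↔-refl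

multiplicities⇒permutation : ∀ {n} (x y : Fin n → ℕ) → (∀ d → multiplicity x d ≡ multiplicity y d) →
  Σ (Fin n ↔ Fin n) (λ σ → ∀ v → x v ≡ y (Inverse.to σ v))
multiplicities⇒permutation x y mult≡ = σ , λ v → sym (proj₂ (Inverse.to (fibre-↔ (x v)) (v , refl)))
  where
  fibre-↔ : ∀ d → fibre x d ↔ fibre y d
  fibre-↔ d = ↔-trans (index (finite-fibre x d))
    (↔-trans (Fin-↔-≡ (trans (size-fibre x d) (trans (mult≡ d) (sym (size-fibre y d)))))
             (↔-sym (index (finite-fibre y d))))
  σ = ↔-trans (Fin-↔-fibres x) (↔-trans (Σ-↔ ↔-refl (fibre-↔ _)) (↔-sym (Fin-↔-fibres y)))

moment-single : ∀ {n} (x : Fin n → ℕ) u {j} → (∀ w → w ≢ u → x w < j) → moment x j ≡ x u C j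
moment-single x u {j} others = ∑-single (λ v → x v C j) u (λ w w≢u → k>n⇒nCk≡0 (others w w≢u))

moment≡C⇒values≤ : ∀ {n} (y : Fin n → ℕ) {m D} → m ≤ D → moment y (suc m) ≡ D C suc m → ∀ v → y v ≤ D
moment≡C⇒values≤ y {m} {D} m≤D moment≡ v with y v ≤? D
... | yes y≤D = y≤D
... | no  y≰D = ⊥-elim (<⇒≱ (begin-strict
  D C suc m        <⟨ C-<-suc m≤D ⟩
  suc D C suc m    ≤⟨ C-monoˡ-≤ (suc m) (≰⇒> y≰D) ⟩
  y v C suc m      ≤⟨ term≤∑ (λ w → y w C suc m) v ⟩
  moment y (suc m) ∎) (≤-reflexive moment≡))
  where open ≤-Reasoning

consecutive-moments⇒values : ∀ {n} (y : Fin n → ℕ) {M D} → M ≤ D → (∀ v → y v ≤ D) →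
  moment y M ≡ D C M → moment y (suc M) ≡ D C suc M → ∀ v → y v < M ⊎ y v ≡ D
consecutive-moments⇒values {n} y {M} {D} M≤D y≤D moment≡ moment≡′ v with M ≤? y v
... | no  M≰y = inj₁ (≰⇒> M≰y)
... | yes M≤y = inj₂ (∸-cancelʳ-≡ M≤y M≤D
        (*-cancelˡ-≡ _ _ (y v C M) {{>-nonZero (C-pos M≤y)}} (trans (sym (C-absorb (y v) M)) (L≡R v))))
  where
  -- termwise C(y, M+1)·(M+1) = C(y, M)·(y ∸ M) ≤ C(y, M)·(D ∸ M), while the two sums agree
  L R : Fin n → ℕ
  L w = (y w C suc M) * suc M
  R w = (y w C M) * (D ∸ M)
  L≤R : ∀ w → L w ≤ R w
  L≤R w = ≤-trans (≤-reflexive (C-absorb (y w) M)) (*-monoʳ-≤ (y w C M) (∸-monoˡ-≤ M (y≤D w)))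
  ∑L≡∑R : ∑[ w < n ] L w ≡ ∑[ w < n ] R w
  ∑L≡∑R = begin
    ∑[ w < n ] L w               ≡⟨ sym (*-distribʳ-sum (suc M) (λ w → y w C suc M)) ⟩
    moment y (suc M) * suc M     ≡⟨ cong (_* suc M) moment≡′ ⟩
    (D C suc M) * suc M          ≡⟨ C-absorb D M ⟩
    (D C M) * (D ∸ M)            ≡⟨ cong (_* (D ∸ M)) (sym moment≡) ⟩
    moment y M * (D ∸ M)         ≡⟨ *-distribʳ-sum (D ∸ M) (λ w → y w C M) ⟩
    ∑[ w < n ] R w               ∎
    where open ≡-Reasoning
  L≡R : ∀ w → L w ≡ R w
  L≡R = pointwise≤∧∑≡⇒≡ L≤R ∑L≡∑R

moment-of-values : ∀ {n} (y : Fin n → ℕ) {M D} → (∀ v → y v < M ⊎ y v ≡ D) → ∀ {j} → M ≤ j →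
  moment y j ≡ multiplicity y D * (D C j)
moment-of-values {n} y {M} {D} values {j} M≤j =
  trans (sum-cong-≗ {n} term) (sym (*-distribʳ-sum (D C j) (λ v → ⟦ y v ≟ D ⟧)))
  where
  term : ∀ v → y v C j ≡ ⟦ y v ≟ D ⟧ * (D C j)
  term v with values v
  ... | inj₁ y<M = trans (k>n⇒nCk≡0 y<j) (sym (⟦⟧*-vanish (y v ≟ D) (λ y≡D → k>n⇒nCk≡0 (subst (_< j) y≡D y<j))))
    where y<j = <-≤-trans y<M M≤j
  ... | inj₂ y≡D = trans (cong (_C j) y≡D) (sym (trans (cong (_* (D C j)) (⟦⟧-yes (y v ≟ D) y≡D)) (*-identityˡ (D C j))))

consecutive-moments⇒tail : ∀ {n} (y : Fin n → ℕ) {M D} → 1 ≤ M → M ≤ D →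
  moment y M ≡ D C M → moment y (suc M) ≡ D C suc M → ∀ {j} → M ≤ j → moment y j ≡ D C j
consecutive-moments⇒tail y {suc m} {D} _ M≤D moment≡ moment≡′ {j} M≤j = begin
  moment y j                    ≡⟨ moment-of-values y values M≤j ⟩
  multiplicity y D * (D C j)    ≡⟨ cong (_* (D C j)) single ⟩
  1 * (D C j)                   ≡⟨ *-identityˡ (D C j) ⟩
  D C j                         ∎
  where
  open ≡-Reasoning
  values = consecutive-moments⇒values y M≤D (moment≡C⇒values≤ y (≤-trans (n≤1+n m) M≤D) moment≡) moment≡ moment≡′
  single : multiplicity y D ≡ 1
  single = *-cancelʳ-≡ _ 1 (D C suc m) {{>-nonZero (C-pos M≤D)}}
    (trans (sym (moment-of-values y values ≤-refl)) (trans moment≡ (sym (*-identityˡ (D C suc m)))))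

moments-agree-large : ∀ {n} (x y : Fin n → ℕ) {k ℓ} → suc (suc ℓ) < k →
  (∀ {j} → j < k → moment x j ≡ moment y j) → ∀ u → k ≤ x u → (∀ w → w ≢ u → x w ≤ ℓ) →
  ∀ j → moment x j ≡ moment y j
moments-agree-large x y {k} {ℓ} ℓ+2<k low u k≤xu small j with j ≤? ℓ
... | yes j≤ℓ = low (<-trans (s≤s j≤ℓ) (<-trans (n<1+n (suc ℓ)) ℓ+2<k))
... | no  j≰ℓ = trans (moment-x (≰⇒> j≰ℓ)) (sym (moment-y (≰⇒> j≰ℓ)))
  where
  ℓ+1<k = <-trans (n<1+n (suc ℓ)) ℓ+2<k
  moment-x : ∀ {i} → ℓ < i → moment x i ≡ x u C i
  moment-x ℓ<i = moment-single x u (λ w w≢u → ≤-<-trans (small w w≢u) ℓ<i)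
  moment-y : ∀ {i} → ℓ < i → moment y i ≡ x u C i
  moment-y = consecutive-moments⇒tail y (s≤s z≤n) (<⇒≤ (<-≤-trans ℓ+1<k k≤xu))
    (trans (sym (low ℓ+1<k)) (moment-x ≤-refl))
    (trans (sym (low ℓ+2<k)) (moment-x (n≤1+n (suc ℓ))))

moments-agree-small : ∀ {n} (x y : Fin n → ℕ) {k} → (∀ {j} → j < k → moment x j ≡ moment y j) →
  (∀ v → x v < k) → (∀ v → y v < k) → ∀ j → moment x j ≡ moment y j
moments-agree-small {n} x y {k} low x<k y<k j with j <? k
... | yes j<k = low j<k
... | no  j≮k = trans (∑-zero _ (λ v → k>n⇒nCk≡0 (<-≤-trans (x<k v) (≮⇒≥ j≮k))))
                      (sym (∑-zero _ (λ v → k>n⇒nCk≡0 (<-≤-trans (y<k v) (≮⇒≥ j≮k)))))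

-- Degrees and decks

listSum-tabulate : ∀ {m n} (f : Fin m → ℕ) (g : Fin n → Fin m) →
  List.sum (List.map f (List.tabulate g)) ≡ ∑[ i < n ] f (g i)
listSum-tabulate {n = zero}  f g = refl
listSum-tabulate {n = suc n} f g = cong (f (g zero) +_) (listSum-tabulate f (g ∘ suc))

listSum-allFin : ∀ n (f : Fin n → ℕ) → List.sum (List.map f (List.allFin n)) ≡ ∑[ i < n ] f i
listSum-allFin n f = listSum-tabulate f (λ i → i)

neighbours : ∀ {n} → Graph n → Fin n → Subset n
neighbours G v = tabulate (adj G v)

∣∩tabulate∣ : ∀ {n} (S : Subset n) (f : Fin n → Bool) → ∣ S ∩ tabulate f ∣ ≡ ∑[ w < n ] (⟦ w ∈? S ⟧ * 𝟙 (f w))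
∣∩tabulate∣ []            f = refl
∣∩tabulate∣ (inside ∷ S)  f = trans (∣∷∣ (f zero) (S ∩ tabulate (f ∘ suc)))
  (cong₂ _+_ (sym (+-identityʳ (𝟙 (f zero)))) (∣∩tabulate∣ S (f ∘ suc)))
∣∩tabulate∣ (outside ∷ S) f = ∣∩tabulate∣ S (f ∘ suc)

degree≡∑ : ∀ {n} (G : Graph n) v → degree G v ≡ ∑[ w < n ] 𝟙 (adj G v w)
degree≡∑ {n} G v = listSum-allFin n (𝟙 ∘ adj G v)

∉neighbours : ∀ {n} (G : Graph n) v → v ∉ neighbours G v
∉neighbours G v v∈N with () ← trans (sym ([]=⇒lookup v∈N)) (trans (lookup∘tabulate (adj G v) v) (irrefl G v))

∣tabulate∣ : ∀ {n} (f : Fin n → Bool) → ∣ tabulate f ∣ ≡ ∑[ w < n ] 𝟙 (f w)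
∣tabulate∣ {zero}  f = refl
∣tabulate∣ {suc n} f = trans (∣∷∣ (f zero) (tabulate (f ∘ suc))) (cong (𝟙 (f zero) +_) (∣tabulate∣ (f ∘ suc)))

degree≡∣neighbours∣ : ∀ {n} (G : Graph n) v → degree G v ≡ ∣ neighbours G v ∣
degree≡∣neighbours∣ G v = trans (degree≡∑ G v) (sym (∣tabulate∣ (adj G v)))

degree≤n : ∀ {n} (G : Graph n) v → degree G v ≤ n
degree≤n G v = subst (_≤ _) (sym (degree≡∣neighbours∣ G v)) (∣p∣≤n (neighbours G v))

finite-Elem : ∀ {n} (S : Subset n) → Finite (Elem S)
finite-Elem {n} S = finite-ΣFin n (_∈ S) (_∈? S) (λ _ → []=-irrelevant)

inducedDegree : ∀ {n} → Graph n → (S : Subset n) → Elem S → ℕ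
inducedDegree G S x = ∑ᶠ (finite-Elem S) (λ y → 𝟙 (adj G (proj₁ x) (proj₁ y)))

inducedDegree-↔ : ∀ {n m} {G : Graph n} {H : Graph m} {S T} (iso : InducedIso G S H T) x →
  inducedDegree G S x ≡ inducedDegree H T (Inverse.to (proj₁ iso) x)
inducedDegree-↔ {G = G} {H} {S} {T} (f , adj≡) x = ∑ᶠ-↔ (finite-Elem S) (finite-Elem T) f
  {λ y → 𝟙 (adj G (proj₁ x) (proj₁ y))} {λ y → 𝟙 (adj H (proj₁ (Inverse.to f x)) (proj₁ y))} (λ y → cong 𝟙 (adj≡ x y))

inducedDegree≡∣∩neighbours∣ : ∀ {n} (G : Graph n) S x → inducedDegree G S x ≡ ∣ S ∩ neighbours G (proj₁ x) ∣
inducedDegree≡∣∩neighbours∣ {n} G S (v , _) =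
  trans (∑ᶠ-ΣFin n (_∈ S) (_∈? S) (λ _ → []=-irrelevant) (𝟙 ∘ adj G v)) (sym (∣∩tabulate∣ S (adj G v)))

inducedMoment : ∀ {n} → Graph n → Subset n → ℕ → ℕ
inducedMoment G S j = ∑ᶠ (finite-Elem S) (λ x → inducedDegree G S x C j)

inducedMoment-↔ : ∀ {n m} {G : Graph n} {H : Graph m} {S T} → InducedIso G S H T → ∀ j →
  inducedMoment G S j ≡ inducedMoment H T j
inducedMoment-↔ {G = G} {H} {S} {T} iso j =
  ∑ᶠ-↔ (finite-Elem S) (finite-Elem T) (proj₁ iso) {λ x → inducedDegree G S x C j} {λ y → inducedDegree H T y C j}
    (λ x → cong (_C j) (inducedDegree-↔ {G = G} {H} iso x))

inducedMoment≡ : ∀ {n} (G : Graph n) S j →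
  inducedMoment G S j ≡ ∑[ v < n ] (⟦ v ∈? S ⟧ * (∣ S ∩ neighbours G v ∣ C j))
inducedMoment≡ {n} G S j =
  trans (∑ᶠ-cong (finite-Elem S) (λ x → cong (_C j) (inducedDegree≡∣∩neighbours∣ G S x)))
        (∑ᶠ-ΣFin n (_∈ S) (_∈? S) (λ _ → []=-irrelevant) (λ v → ∣ S ∩ neighbours G v ∣ C j))

finite-KSubset : ∀ n k → Finite (KSubset n k)
finite-KSubset n k = finite-Σ (finite-Subset n) (λ S → ∣ S ∣ ≟ k) (λ _ → ≡-irrelevant)

deckMoment : ∀ {n} → ℕ → Graph n → ℕ → ℕ
deckMoment {n} k G j = ∑ᶠ (finite-KSubset n k) (λ S → inducedMoment G (proj₁ S) j)

deckMoment-invariant : ∀ {n} k (G H : Graph n) → SameDeck k G H → ∀ j → deckMoment k G j ≡ deckMoment k H j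
deckMoment-invariant {n} k G H (φ , iso) j =
  ∑ᶠ-↔ (finite-KSubset n k) (finite-KSubset n k) φ {λ S → inducedMoment G (proj₁ S) j} {λ S → inducedMoment H (proj₁ S) j}
    (λ S → inducedMoment-↔ {G = G} {H} (iso S) j)

deckMoment≡ : ∀ {n} (G : Graph n) j r → deckMoment (suc (j + r)) G j ≡ ((n ∸ suc j) C r) * moment (degree G) j
deckMoment≡ {n} G j r = begin
  deckMoment k G j
    ≡⟨ ∑ᶠ-Σ (finite-Subset n) (λ S → ∣ S ∣ ≟ k) (λ _ → ≡-irrelevant) (λ S → inducedMoment G S j) ⟩
  ∑ˢ (λ S → ⟦ ∣ S ∣ ≟ k ⟧ * inducedMoment G S j)
    ≡⟨ ∑ᶠ-cong (finite-Subset n) (λ S → trans (cong (⟦ ∣ S ∣ ≟ k ⟧ *_) (inducedMoment≡ G S j))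
                                              (*-distribˡ-sum ⟦ ∣ S ∣ ≟ k ⟧ (λ v → ⟦ v ∈? S ⟧ * (∣ S ∩ N v ∣ C j)))) ⟩
  ∑ˢ (λ S → ∑[ v < n ] (⟦ ∣ S ∣ ≟ k ⟧ * (⟦ v ∈? S ⟧ * (∣ S ∩ N v ∣ C j))))
    ≡⟨ ∑-comm (λ i v → ⟦ ∣ from i ∣ ≟ k ⟧ * (⟦ v ∈? from i ⟧ * (∣ from i ∩ N v ∣ C j))) ⟩
  ∑[ v < n ] ∑ˢ (λ S → ⟦ ∣ S ∣ ≟ k ⟧ * (⟦ v ∈? S ⟧ * (∣ S ∩ N v ∣ C j)))
    ≡⟨ sum-cong-≗ (λ v → subsetMoment-∈≡ (N v) (∉neighbours G v) j r) ⟩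
  ∑[ v < n ] ((∣ N v ∣ C j) * K)
    ≡⟨ sum-cong-≗ (λ v → trans (*-comm (∣ N v ∣ C j) K) (cong (λ d → K * (d C j)) (sym (degree≡∣neighbours∣ G v)))) ⟩
  ∑[ v < n ] (K * (degree G v C j))
    ≡⟨ sym (*-distribˡ-sum K (λ v → degree G v C j)) ⟩
  K * moment (degree G) j
    ∎
  where
  open ≡-Reasoning
  k = suc (j + r)
  K = (n ∸ suc j) C r
  N = neighbours G
  from = Inverse.from (index (finite-Subset n))

sameDeck⇒moment : ∀ {n k} (G H : Graph n) → SameDeck k G H → k ≤ n → ∀ {j} → j < k →
  moment (degree G) j ≡ moment (degree H) j
sameDeck⇒moment {n} {k} G H deck k≤n {j} j<k = *-cancelˡ-≡ _ _ K {{>-nonZero (C-pos r≤n∸suc-j)}} (begin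
  K * moment (degree G) j        ≡⟨ sym (deckMoment≡ G j r) ⟩
  deckMoment (suc (j + r)) G j   ≡⟨ cong (λ m → deckMoment m G j) j+1+r≡k ⟩
  deckMoment k G j               ≡⟨ deckMoment-invariant k G H deck j ⟩
  deckMoment k H j               ≡⟨ cong (λ m → deckMoment m H j) (sym j+1+r≡k) ⟩
  deckMoment (suc (j + r)) H j   ≡⟨ deckMoment≡ H j r ⟩
  K * moment (degree H) j        ∎)
  where
  open ≡-Reasoning
  r = k ∸ suc j
  K = (n ∸ suc j) C r
  j+1+r≡k : suc (j + r) ≡ k
  j+1+r≡k = m+[n∸m]≡n j<k
  r≤n∸suc-j : r ≤ n ∸ suc j
  r≤n∸suc-j = ∸-monoˡ-≤ (suc j) k≤n

-- Degrees in trees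

listSum-filter : ∀ {A : Set} {P : A → Set} (P? : Decidable P) (f : A → ℕ) (xs : List.List A) →
  List.sum (List.map f (List.filter P? xs)) ≡ List.sum (List.map (λ x → ⟦ P? x ⟧ * f x) xs)
listSum-filter P? f List.[] = refl
listSum-filter P? f (x List.∷ xs) with P? x
... | yes _ = cong₂ _+_ (sym (+-identityʳ (f x))) (listSum-filter P? f xs)
... | no  _ = listSum-filter P? f xs

edgeCount≡∑ : ∀ {n} (G : Graph n) → edgeCount G ≡ ∑[ i < n ] ∑[ j < n ] (⟦ i Fin.<? j ⟧ * 𝟙 (adj G i j))
edgeCount≡∑ {n} G = trans (listSum-allFin n (λ i → List.sum (List.map (𝟙 ∘ adj G i) (List.filter (i Fin.<?_) (List.allFin n)))))
  (sum-cong-≗ {n} (λ i → trans (listSum-filter (i Fin.<?_) (𝟙 ∘ adj G i) (List.allFin n))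
                               (listSum-allFin n (λ j → ⟦ i Fin.<? j ⟧ * 𝟙 (adj G i j)))))

adjacency-split : ∀ {n} (G : Graph n) i j → 𝟙 (adj G i j) ≡ ⟦ i Fin.<? j ⟧ * 𝟙 (adj G i j) + ⟦ j Fin.<? i ⟧ * 𝟙 (adj G j i)
adjacency-split G i j = trans (by-order i j) (cong (λ b → ⟦ i Fin.<? j ⟧ * 𝟙 (adj G i j) + ⟦ j Fin.<? i ⟧ * 𝟙 b) (Graph.sym G i j))
  where
  by-order : ∀ i j → 𝟙 (adj G i j) ≡ ⟦ i Fin.<? j ⟧ * 𝟙 (adj G i j) + ⟦ j Fin.<? i ⟧ * 𝟙 (adj G i j)
  by-order i j with Fin.<-cmp i j
  ... | tri< i<j _ j≮i rewrite ⟦⟧-yes (i Fin.<? j) i<j | ⟦⟧-no (j Fin.<? i) j≮i = sym (trans (+-identityʳ _) (+-identityʳ _))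
  ... | tri> i≮j _ j<i rewrite ⟦⟧-no (i Fin.<? j) i≮j | ⟦⟧-yes (j Fin.<? i) j<i = sym (+-identityʳ _)
  ... | tri≈ _ refl _ rewrite irrefl G i = sym (cong₂ _+_ (*-zeroʳ ⟦ i Fin.<? i ⟧) (*-zeroʳ ⟦ i Fin.<? i ⟧))

handshake : ∀ {n} (G : Graph n) → ∑[ v < n ] degree G v ≡ 2 * edgeCount G
handshake {n} G = begin
  ∑[ i < n ] degree G i
    ≡⟨ sum-cong-≗ {n} (λ i → trans (degree≡∑ G i) (sum-cong-≗ {n} (adjacency-split G i))) ⟩
  ∑[ i < n ] ∑[ j < n ] (below i j + below j i)
    ≡⟨ sum-cong-≗ {n} (λ i → ∑-distrib-+ (below i) (λ j → below j i)) ⟩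
  ∑[ i < n ] (∑[ j < n ] below i j + ∑[ j < n ] below j i)
    ≡⟨ ∑-distrib-+ (λ i → ∑[ j < n ] below i j) (λ i → ∑[ j < n ] below j i) ⟩
  E + ∑[ i < n ] ∑[ j < n ] below j i
    ≡⟨ cong (E +_) (∑-comm (λ i j → below j i)) ⟩
  E + E
    ≡⟨ cong (E +_) (sym (+-identityʳ E)) ⟩
  2 * E
    ≡⟨ cong (2 *_) (sym (edgeCount≡∑ G)) ⟩
  2 * edgeCount G
    ∎
  where
  open ≡-Reasoning
  below : Fin n → Fin n → ℕ
  below i j = ⟦ i Fin.<? j ⟧ * 𝟙 (adj G i j)
  E = ∑[ i < n ] ∑[ j < n ] below i j

first-step : ∀ {n} {G : Graph n} {v u} → Walk G v u → v ≢ u → Σ (Fin n) (λ w → adj G v w ≡ true)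
first-step here       v≢v = ⊥-elim (v≢v refl)
first-step (step e _) _   = _ , e

connected⇒degree-pos : ∀ {n} (G : Graph n) → Connected G → 2 ≤ n → ∀ v → 1 ≤ degree G v
connected⇒degree-pos {suc zero} G connected (s≤s ()) v
connected⇒degree-pos {suc (suc _)} G connected _ v with first-step (connected v (punchIn v zero)) (≢-sym (punchInᵢ≢i v zero))
... | w , v~w = begin
  1                          ≡⟨ cong 𝟙 (sym v~w) ⟩
  𝟙 (adj G v w)              ≤⟨ term≤∑ (𝟙 ∘ adj G v) w ⟩
  ∑[ u < _ ] 𝟙 (adj G v u)   ≡⟨ sym (degree≡∑ G v) ⟩
  degree G v                 ∎
  where open ≤-Reasoning

-- writing each value as 1 + (x v ∸ 1), the excess over 1 sums to n ∸ 2
positive-sum-pair≤ : ∀ {n} (x : Fin n → ℕ) → (∀ v → 1 ≤ x v) → ∑[ v < n ] x v ≡ 2 * (n ∸ 1) →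
  ∀ {u w} → u ≢ w → x u + x w ≤ n
positive-sum-pair≤ {suc m} x x≥1 ∑x≡2m {u} {w} u≢w = begin
  x u + x w                 ≡⟨ cong₂ _+_ (x≡1+y u) (x≡1+y w) ⟩
  suc (y u) + suc (y w)     ≡⟨ cong suc (+-suc (y u) (y w)) ⟩
  suc (suc (y u + y w))     ≤⟨ s≤s (+-cancelˡ-≤ m _ _ excess≤) ⟩
  suc m                     ∎
  where
  open ≤-Reasoning
  y : Fin (suc m) → ℕ
  y v = x v ∸ 1
  x≡1+y : ∀ v → x v ≡ 1 + y v
  x≡1+y v = sym (m+[n∸m]≡n (x≥1 v))
  excess≤ : m + suc (y u + y w) ≤ m + m
  excess≤ = begin
    m + suc (y u + y w)                     ≡⟨ +-suc m _ ⟩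
    suc m + (y u + y w)                     ≤⟨ +-monoʳ-≤ (suc m) (pair≤∑ y u≢w) ⟩
    suc m + ∑[ v < suc m ] y v              ≡⟨ cong (_+ ∑[ v < suc m ] y v) (sym (∑-ones (suc m))) ⟩
    ∑[ v < suc m ] 1 + ∑[ v < suc m ] y v   ≡⟨ sym (∑-distrib-+ (λ _ → 1) y) ⟩
    ∑[ v < suc m ] (1 + y v)                ≡⟨ sum-cong-≗ {suc m} (λ v → sym (x≡1+y v)) ⟩
    ∑[ v < suc m ] x v                      ≡⟨ ∑x≡2m ⟩
    m + (m + 0)                             ≡⟨ cong (m +_) (+-identityʳ m) ⟩
    m + m                                   ∎

tree-degree-sum : ∀ {n} (G : Graph n) → IsTree G → ∑[ v < n ] degree G v ≡ 2 * (n ∸ 1)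
tree-degree-sum G (_ , edges) = trans (handshake G) (cong (2 *_) edges)

tree-two-degrees≤ : ∀ {n} (G : Graph n) → IsTree G → 2 ≤ n → ∀ {u w} → u ≢ w → degree G u + degree G w ≤ n
tree-two-degrees≤ G tree@(connected , _) 2≤n =
  positive-sum-pair≤ (degree G) (connected⇒degree-pos G connected 2≤n) (tree-degree-sum G tree)


tree-large-degree : ∀ {n} (G : Graph n) → IsTree G → 2 ≤ n → ∀ {k ℓ} → k + ℓ ≡ n →
  ∀ {u} → k ≤ degree G u → ∀ w → w ≢ u → degree G w ≤ ℓ
tree-large-degree G tree 2≤n {k} {ℓ} k+ℓ≡n {u} k≤du w w≢u = +-cancelˡ-≤ k _ _ (begin
  k + degree G w            ≤⟨ +-monoˡ-≤ (degree G w) k≤du ⟩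
  degree G u + degree G w   ≤⟨ tree-two-degrees≤ G tree 2≤n (≢-sym w≢u) ⟩
  _                         ≡⟨ sym k+ℓ≡n ⟩
  k + ℓ                     ∎)
  where open ≤-Reasoning



tree-degree-moments : ∀ {n k ℓ} (G H : Graph n) → IsTree G → IsTree H → 2 ≤ n → k + ℓ ≡ n → suc (suc ℓ) < k →
  (∀ {j} → j < k → moment (degree G) j ≡ moment (degree H) j) → ∀ j → moment (degree G) j ≡ moment (degree H) j
tree-degree-moments {k = k} G H treeG treeH 2≤n k+ℓ≡n ℓ+2<k low
  with any? (λ u → k ≤? degree G u) | any? (λ u → k ≤? degree H u)
... | yes (u , k≤dᵤ) | _ =
  moments-agree-large (degree G) (degree H) ℓ+2<k low u k≤dᵤ (tree-large-degree G treeG 2≤n k+ℓ≡n k≤dᵤ)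
... | no _ | yes (u , k≤dᵤ) = λ j → sym
  (moments-agree-large (degree H) (degree G) ℓ+2<k (sym ∘ low) u k≤dᵤ (tree-large-degree H treeH 2≤n k+ℓ≡n k≤dᵤ) j)
... | no G-small | no H-small =
  moments-agree-small (degree G) (degree H) low (λ v → ≰⇒> (G-small ∘ (v ,_))) (λ v → ≰⇒> (H-small ∘ (v ,_)))

corollary2p10 : (ℓ n : ℕ) → 1 ≤ ℓ → 2 * ℓ + 3 ≤ n →
    (G H : Graph n) → IsTree G → IsTree H →
    SameDeck (n ∸ ℓ) G H → SameDegreeList G H
-- the argument never uses ℓ ≥ 1 (for ℓ = 0 the deck is the graph itself)
corollary2p10 ℓ n _ 2ℓ+3≤n G H treeG treeH deck =
  multiplicities⇒permutation (degree G) (degree H)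
    (moments⇒multiplicities (degree G) (degree H) n (degree≤n G) (degree≤n H)
      (tree-degree-moments G H treeG treeH 2≤n (m∸n+n≡m ℓ≤n) ℓ+2<n∸ℓ
        (sameDeck⇒moment G H deck (m∸n≤m n ℓ))))
  where
  bound : 3 + ℓ + ℓ ≤ n
  bound = subst (_≤ n) (sym (rearrange ℓ)) 2ℓ+3≤n
    where
    rearrange : ∀ m → 3 + m + m ≡ 2 * m + 3
    rearrange = solve-∀
  ℓ≤n : ℓ ≤ n
  ℓ≤n = ≤-trans (m≤n+m ℓ (3 + ℓ)) bound
  ℓ+2<n∸ℓ : suc (suc ℓ) < n ∸ ℓ
  ℓ+2<n∸ℓ = m+n≤o⇒m≤o∸n (3 + ℓ) bound
  2≤n : 2 ≤ n
  2≤n = ≤-trans (s≤s (s≤s z≤n)) bound
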